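{- Let $(X,\odot,\ell,r)$ be an $\ell r$-multimagma, and for $A\subseteq X$ put $\textit{dom}(A)=\ell(A)=\{\ell(a)\mid a\in A\}$ and $\textit{cod}(A)=r(A)=\{r(a)\mid a\in A\}$. \begin{enumerate} \item Then $(\mathcal{P}X,\subseteq,\odot,E,\textit{dom},\textit{cod})$ is a boolean modal prequantale whose complete boolean algebra is atomic. \item If $X$ is an $\ell r$-multisemigroup, it is a weakly local modal quantale. \item If $X$ is a local $\ell r$-multisemigroup, it is a modal quantale. \end{enumerate}
   Context: A multimagma is a non-empty set $X$ with $\odot:X\times X\to\mathcal{P}X$; extended to subsets by $A\odot B=\bigcup\{a\odot b\mid a\in A,b\in B\}$; $D_{xy}$ means $x\odot y\neq\emptyset$. An $\ell r$-multimagma is a multimagma with $\ell,r:X\to X$ such that $D_{xy}\Rightarrow r(x)=\ell(y)$, $\ell(x)\odot x=\{x\}$, $x\odot r(x)=\{x\}$ for all $x,y$. An $\ell r$-multisemigroup additionally satisfies $x\odot(y\odot z)=(x\odot y)\odot z$; it is local if $r(x)=\ell(y)\Rightarrow D_{xy}$. $E=\{x\in X\mid\ell(x)=x\}$. A prequantale $(Q,\le,\cdot,1)$ is a complete lattice with a binary operation $\cdot$ with two-sided unit $1$ preserving all sups in each argument; $\bot$ least element. A modal prequantale: prequantale with $\textit{dom},\textit{cod}:Q\to Q$ such that $\alpha\le\textit{dom}(\alpha)\cdot\alpha$, $\textit{dom}(\textit{dom}(\alpha)\cdot\beta)=\textit{dom}(\alpha)\cdot\textit{dom}(\beta)$, $\textit{dom}(\alpha)\le1$,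 $\textit{dom}(\bot)=\bot$, $\textit{dom}(\alpha\vee\beta)=\textit{dom}(\alpha)\vee\textit{dom}(\beta)$, the opposite axioms for $\textit{cod}$ (arguments of $\cdot$ swapped), and $\textit{dom}\circ\textit{cod}=\textit{cod}$, $\textit{cod}\circ\textit{dom}=\textit{dom}$. It is boolean if its lattice is a complete boolean algebra. A weakly local modal quantale is a modal prequantale with associative $\cdot$. A modal quantale is a prequantale with associative $\cdot$ and $\textit{dom},\textit{cod}$ satisfying the same axioms with the export axioms replaced by $\textit{dom}(\alpha\cdot\textit{dom}(\beta))=\textit{dom}(\alpha\cdot\beta)$ and $\textit{cod}(\textit{cod}(\alpha)\cdot\beta)=\textit{cod}(\alpha\cdot\beta)$. -}

module Defs where

open import Level using (Level; _⊔_; suc; 0ℓ; Lift)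
open import Data.Bool using (Bool; true; false)
open import Data.Empty using (⊥)
open import Data.Product using (Σ; ∃; ∃-syntax; _×_; _,_)
open import Data.Sum using (_⊎_)
open import Relation.Nullary using (¬_; Dec)
open import Relation.Binary.PropositionalEquality using (_≡_)
open import Relation.Unary using (Pred; _∈_; _⊆_)

-- A carrier Q with an order _≤_; equality of elements of Q is the
-- equivalence induced by the order (x ≤ y and y ≤ x), so antisymmetry
-- holds by construction.

module Order {q ℓ : Level} {Q : Set q} (_≤_ : Q → Q → Set ℓ) where

  infix 4 _≈_
  _≈_ : Q → Q → Set ℓ
  x ≈ y = (x ≤ y) × (y ≤ x)

module Sups {q ι : Level} {Q : Set q} (⋁ : {I : Set ι} → (I → Q) → Q) where

  ⊥Q : Q
  ⊥Q = ⋁ {Lift ι ⊥} (λ ())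

  _∨_ : Q → Q → Q
  a ∨ b = ⋁ {Lift ι Bool} (λ { (Level.lift true) → a ; (Level.lift false) → b })

record IsPrequantale {q ℓ ι : Level} (Q : Set q) (_≤_ : Q → Q → Set ℓ)
       (⋁ : {I : Set ι} → (I → Q) → Q) (_·_ : Q → Q → Q) (𝟏 : Q)
       : Set (q ⊔ ℓ ⊔ suc ι) where
  open Order _≤_
  field
    ≤-refl  : ∀ {x} → x ≤ x
    ≤-trans : ∀ {x y z} → x ≤ y → y ≤ z → x ≤ z
    ⋁-upper : ∀ {I : Set ι} (f : I → Q) (i : I) → f i ≤ ⋁ f
    ⋁-least : ∀ {I : Set ι} (f : I → Q) (u : Q) → (∀ i → f i ≤ u) → ⋁ f ≤ u
    ·-cong  : ∀ {x x' y y'} → x ≈ x' → y ≈ y' → (x · y) ≈ (x' · y')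
    ·-⋁ˡ    : ∀ (a : Q) {I : Set ι} (f : I → Q) → (a · ⋁ f) ≈ ⋁ (λ i → a · f i)
    ·-⋁ʳ    : ∀ (a : Q) {I : Set ι} (f : I → Q) → (⋁ f · a) ≈ ⋁ (λ i → f i · a)
    identityˡ : ∀ a → (𝟏 · a) ≈ a
    identityʳ : ∀ a → (a · 𝟏) ≈ a

-- Axioms on dom/cod common to modal prequantales and modal quantales
-- (everything except the export/locality axioms).
record IsModalBase {q ℓ ι : Level} (Q : Set q) (_≤_ : Q → Q → Set ℓ)
       (⋁ : {I : Set ι} → (I → Q) → Q) (_·_ : Q → Q → Q) (𝟏 : Q)
       (dom cod : Q → Q) : Set (q ⊔ ℓ ⊔ suc ι) where
  open Order _≤_
  open Sups ⋁
  field
    isPrequantale : IsPrequantale Q _≤_ ⋁ _·_ 𝟏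
    dom-cong   : ∀ {x y} → x ≈ y → dom x ≈ dom y
    cod-cong   : ∀ {x y} → x ≈ y → cod x ≈ cod y
    dom-absorb : ∀ a → a ≤ (dom a · a)
    dom-subid  : ∀ a → dom a ≤ 𝟏
    dom-strict : dom ⊥Q ≈ ⊥Q
    dom-join   : ∀ a b → dom (a ∨ b) ≈ (dom a ∨ dom b)
    cod-absorb : ∀ a → a ≤ (a · cod a)
    cod-subid  : ∀ a → cod a ≤ 𝟏
    cod-strict : cod ⊥Q ≈ ⊥Q
    cod-join   : ∀ a b → cod (a ∨ b) ≈ (cod a ∨ cod b)
    dom∘cod    : ∀ a → dom (cod a) ≈ cod a
    cod∘dom    : ∀ a → cod (dom a) ≈ dom a
  open IsPrequantale isPrequantale public

record IsModalPrequantale {q ℓ ι : Level} (Q : Set q) (_≤_ : Q → Q → Set ℓ)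
       (⋁ : {I : Set ι} → (I → Q) → Q) (_·_ : Q → Q → Q) (𝟏 : Q)
       (dom cod : Q → Q) : Set (q ⊔ ℓ ⊔ suc ι) where
  open Order _≤_
  field
    isModalBase : IsModalBase Q _≤_ ⋁ _·_ 𝟏 dom cod
    dom-export  : ∀ a b → dom (dom a · b) ≈ (dom a · dom b)
    cod-export  : ∀ a b → cod (b · cod a) ≈ (cod b · cod a)
  open IsModalBase isModalBase public

record IsWeaklyLocalModalQuantale {q ℓ ι : Level} (Q : Set q) (_≤_ : Q → Q → Set ℓ)
       (⋁ : {I : Set ι} → (I → Q) → Q) (_·_ : Q → Q → Q) (𝟏 : Q)
       (dom cod : Q → Q) : Set (q ⊔ ℓ ⊔ suc ι) where
  open Order _≤_
  field
    isModalPrequantale : IsModalPrequantale Q _≤_ ⋁ _·_ 𝟏 dom cod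
    ·-assoc : ∀ a b c → ((a · b) · c) ≈ (a · (b · c))

record IsModalQuantale {q ℓ ι : Level} (Q : Set q) (_≤_ : Q → Q → Set ℓ)
       (⋁ : {I : Set ι} → (I → Q) → Q) (_·_ : Q → Q → Q) (𝟏 : Q)
       (dom cod : Q → Q) : Set (q ⊔ ℓ ⊔ suc ι) where
  open Order _≤_
  field
    isModalBase : IsModalBase Q _≤_ ⋁ _·_ 𝟏 dom cod
    ·-assoc     : ∀ a b c → ((a · b) · c) ≈ (a · (b · c))
    dom-local   : ∀ a b → dom (a · dom b) ≈ dom (a · b)
    cod-local   : ∀ a b → cod (cod a · b) ≈ cod (a · b)

-- The complete lattice (Q, ≤, ⋁) is a complete boolean algebra which is
-- atomic.  Meets, top and complements are supplied as data (they are
-- uniquely determined up to ≈ by their properties).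
record IsAtomicBoolean {q ℓ ι : Level} (Q : Set q) (_≤_ : Q → Q → Set ℓ)
       (⋁ : {I : Set ι} → (I → Q) → Q) : Set (q ⊔ ℓ) where
  open Order _≤_
  open Sups ⋁
  field
    ⊤Q      : Q
    ⊤-max   : ∀ a → a ≤ ⊤Q
    _⊓_     : Q → Q → Q
    ⊓-lowerˡ : ∀ a b → (a ⊓ b) ≤ a
    ⊓-lowerʳ : ∀ a b → (a ⊓ b) ≤ b
    ⊓-glb   : ∀ a b c → c ≤ a → c ≤ b → c ≤ (a ⊓ b)
    distrib : ∀ a b c → (a ⊓ (b ∨ c)) ≤ ((a ⊓ b) ∨ (a ⊓ c))
    compl   : Q → Q
    compl-⊓ : ∀ a → (a ⊓ compl a) ≤ ⊥Q
    compl-∨ : ∀ a → ⊤Q ≤ (a ∨ compl a)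
  IsAtom : Q → Set (q ⊔ ℓ)
  IsAtom a = (¬ (a ≤ ⊥Q)) × (∀ b → b ≤ a → (b ≤ ⊥Q) ⊎ (a ≤ b))
  field
    atomic : ∀ a → ¬ (a ≤ ⊥Q) → ∃[ t ] (IsAtom t × t ≤ a)

lift⊙ : {X : Set} → (X → X → Pred X 0ℓ) → Pred X 0ℓ → Pred X 0ℓ → Pred X 0ℓ
lift⊙ _⊙_ A B = λ z → ∃[ a ] ∃[ b ] (a ∈ A × b ∈ B × z ∈ (a ⊙ b))

_≐_ : {X : Set} → Pred X 0ℓ → Pred X 0ℓ → Set
A ≐ B = (A ⊆ B) × (B ⊆ A)

｛_｝ : {X : Set} → X → Pred X 0ℓ
｛ x ｝ = λ y → y ≡ x

record LRMultimagma : Set₁ where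
  field
    Carrier : Set
    inhabitant : Carrier
    _⊙_ : Carrier → Carrier → Pred Carrier 0ℓ
    ℓ r : Carrier → Carrier
  D : Carrier → Carrier → Set
  D x y = ∃[ z ] (z ∈ (x ⊙ y))
  field
    D⇒r≡ℓ : ∀ x y → D x y → r x ≡ ℓ y
    ℓ-unit : ∀ x → (ℓ x ⊙ x) ≐ ｛ x ｝
    r-unit : ∀ x → (x ⊙ r x) ≐ ｛ x ｝
  _⊙ₚ_ : Pred Carrier 0ℓ → Pred Carrier 0ℓ → Pred Carrier 0ℓ
  _⊙ₚ_ = lift⊙ _⊙_
  IsMultisemigroup : Set
  IsMultisemigroup = ∀ x y z → (｛ x ｝ ⊙ₚ (y ⊙ z)) ≐ ((x ⊙ y) ⊙ₚ ｛ z ｝)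
  IsLocal : Set
  IsLocal = ∀ x y → r x ≡ ℓ y → D x y

module PowerSet (M : LRMultimagma) where
  open LRMultimagma M

  PX : Set₁
  PX = Pred Carrier 0ℓ

  _⊆′_ : PX → PX → Set
  A ⊆′ B = A ⊆ B

  ⋃ : {I : Set} → (I → PX) → PX
  ⋃ {I} f = λ x → Σ I (λ i → x ∈ f i)

  E : PX
  E = λ x → ℓ x ≡ x

  dom : PX → PX
  dom A = λ y → ∃[ a ] (a ∈ A × ℓ a ≡ y)

  cod : PX → PX
  cod A = λ y → ∃[ a ] (a ∈ A × r a ≡ y)

ExcludedMiddle : Set₁
ExcludedMiddle = (P : Set) → Dec P

-- The whole structure is driven by one fact about ℓr-multimagmas: an element
-- e with ℓ e = e acts as a partial identity, e ⊙ b being {b} when e = ℓ b and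
-- empty otherwise.  Hence a set P of such elements acts on subsets by
-- restriction, P ⊙ B = {b ∈ B | ℓ b ∈ P} and B ⊙ P = {b ∈ B | r b ∈ P}; this
-- gives the units, absorption and export laws at once.  Associativity of the
-- multioperation lifts to subsets, and in a multisemigroup ℓ and r are
-- constant on each a ⊙ b (with values ℓ a and r b), which together with
-- locality gives the locality laws of a modal quantale.  The boolean and
-- atomic structure is that of a powerset, with singletons as atoms.
module Submission where

open import Defs
open import Data.Product using (_×_)
open PowerSet using (PX; _⊆′_; ⋃; E; dom; cod)
open LRMultimagma using (IsMultisemigroup; IsLocal; _⊙ₚ_)

open import Level as Level using (0ℓ; lift)
open import Data.Bool using (true; false)
open import Data.Empty using (⊥-elim)
open import Data.Product using (Σ; ∃-syntax; _,_; proj₁; proj₂; swap)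
open import Data.Sum using (_⊎_; inj₁; inj₂)
open import Data.Unit using (tt)
open import Relation.Nullary using (¬_; yes; no)
open import Relation.Binary.PropositionalEquality
  using (_≡_; refl; sym; trans; cong; subst; module ≡-Reasoning)
open import Relation.Binary.Bundles using (Setoid)
open import Relation.Unary using (Pred; _∈_; _∉_; _⊆_; _∩_; _⊢_; ∁; U)
open import Relation.Unary.Properties using (≐-refl; ≐-sym; ≐-trans)

module PowersetOf (X : Set) where

  ⋁ : {I : Set} → (I → Pred X 0ℓ) → Pred X 0ℓ
  ⋁ {I} f x = Σ I (λ i → x ∈ f i)

  open Sups ⋁ public

  private variable
    x : X
    A A′ B B′ C : Pred X 0ℓ

  ≐-setoid : Setoid (Level.suc 0ℓ) 0ℓ
  ≐-setoid = record
    { Carrier       = Pred X 0ℓ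
    ; _≈_           = _≐_
    ; isEquivalence = record { refl = ≐-refl ; sym = ≐-sym ; trans = ≐-trans }
    }

  ∩-comm : (A ∩ B) ≐ (B ∩ A)
  ∩-comm = swap , swap

  ∉⊥Q : x ∉ ⊥Q
  ∉⊥Q (lift () , _)

  -- PowerSet.dom and PowerSet.cod are definitionally image ℓ and image r.
  image : (X → X) → Pred X 0ℓ → Pred X 0ℓ
  image f A y = ∃[ a ] (a ∈ A × f a ≡ y)

  image-mono : ∀ f → A ⊆ B → image f A ⊆ image f B
  image-mono f A⊆B (a , a∈A , fa≡y) = a , A⊆B a∈A , fa≡y

  image-cong : ∀ f → A ≐ B → image f A ≐ image f B
  image-cong f (A⊆B , B⊆A) = image-mono f A⊆B , image-mono f B⊆A

  image-∩-⊢ : ∀ f → image f (A ∩ (f ⊢ B)) ≐ (image f A ∩ B)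
  image-∩-⊢ f =
      (λ { (a , (a∈A , fa∈B) , refl) → (a , a∈A , refl) , fa∈B })
    , (λ { ((a , a∈A , refl) , fa∈B) → a , (a∈A , fa∈B) , refl })

  image-⊥ : ∀ f → image f ⊥Q ≐ ⊥Q
  image-⊥ f = (λ { (_ , (lift () , _) , _) }) , (λ { (lift () , _) })

  image-∨ : ∀ f → image f (A ∨ B) ≐ (image f A ∨ image f B)
  image-∨ f =
      (λ { (a , (lift true  , a∈A) , fa≡y) → lift true  , a , a∈A , fa≡y
         ; (b , (lift false , b∈B) , fb≡y) → lift false , b , b∈B , fb≡y })
    , (λ { (lift true  , a , a∈A , fa≡y) → a , (lift true  , a∈A) , fa≡y
         ; (lift false , b , b∈B , fb≡y) → b , (lift false , b∈B) , fb≡y })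

  image-absorb : ∀ f g → (∀ x → f (g x) ≡ g x) → image f (image g A) ≐ image g A
  image-absorb f g fg≡g =
      (λ { (_ , (a , a∈A , refl) , refl) → a , a∈A , sym (fg≡g a) })
    , (λ { (a , a∈A , refl) → g a , (a , a∈A , refl) , fg≡g a })

  module Lifted (_⊙_ : X → X → Pred X 0ℓ) where

    infixl 30 _·_
    _·_ : Pred X 0ℓ → Pred X 0ℓ → Pred X 0ℓ
    _·_ = lift⊙ _⊙_

    ·-mono : A ⊆ A′ → B ⊆ B′ → A · B ⊆ A′ · B′
    ·-mono A⊆A′ B⊆B′ (a , b , a∈A , b∈B , z∈ab) = a , b , A⊆A′ a∈A , B⊆B′ b∈B , z∈ab

    ·-⋁ˡ : ∀ A {I : Set} (f : I → Pred X 0ℓ) → A · ⋁ f ≐ ⋁ (λ i → A · f i)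
    ·-⋁ˡ A f =
        (λ (a , b , a∈A , (i , b∈fi) , z∈ab) → i , a , b , a∈A , b∈fi , z∈ab)
      , (λ (i , a , b , a∈A , b∈fi , z∈ab) → a , b , a∈A , (i , b∈fi) , z∈ab)

    ·-⋁ʳ : ∀ A {I : Set} (f : I → Pred X 0ℓ) → ⋁ f · A ≐ ⋁ (λ i → f i · A)
    ·-⋁ʳ A f =
        (λ (a , b , (i , a∈fi) , b∈A , z∈ab) → i , a , b , a∈fi , b∈A , z∈ab)
      , (λ (i , a , b , a∈fi , b∈A , z∈ab) → a , b , (i , a∈fi) , b∈A , z∈ab)

    ·-assoc : (∀ x y z → lift⊙ _⊙_ ｛ x ｝ (y ⊙ z) ≐ lift⊙ _⊙_ (x ⊙ y) ｛ z ｝) →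
              ∀ A B C → (A · B) · C ≐ A · (B · C)
    ·-assoc assoc A B C =
        (λ (w , c , (a , b , a∈A , b∈B , w∈ab) , c∈C , z∈wc) →
           let (a′ , v , a′≡a , v∈bc , z∈a′v) = proj₂ (assoc a b c) (w , c , w∈ab , refl , z∈wc)
           in a′ , v , subst A (sym a′≡a) a∈A , (b , c , b∈B , c∈C , v∈bc) , z∈a′v)
      , (λ (a , v , a∈A , (b , c , b∈B , c∈C , v∈bc) , z∈av) →
           let (w , c′ , w∈ab , c′≡c , z∈wc′) = proj₁ (assoc a b c) (a , v , refl , v∈bc , z∈av)
           in w , c′ , (a , b , a∈A , b∈B , w∈ab) , subst C (sym c′≡c) c∈C , z∈wc′)

    isPrequantale : ∀ 𝟏 → (∀ A → 𝟏 · A ≐ A) → (∀ A → A · 𝟏 ≐ A) →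
                    IsPrequantale (Pred X 0ℓ) _⊆_ ⋁ _·_ 𝟏
    isPrequantale 𝟏 identityˡ identityʳ = record
      { ≤-refl    = λ x∈A → x∈A
      ; ≤-trans   = λ A⊆B B⊆C x∈A → B⊆C (A⊆B x∈A)
      ; ⋁-upper   = λ f i x∈fi → i , x∈fi
      ; ⋁-least   = λ f u fi⊆u (i , x∈fi) → fi⊆u i x∈fi
      ; ·-cong    = λ (A⊆A′ , A′⊆A) (B⊆B′ , B′⊆B) → ·-mono A⊆A′ B⊆B′ , ·-mono A′⊆A B′⊆B
      ; ·-⋁ˡ      = ·-⋁ˡ
      ; ·-⋁ʳ      = ·-⋁ʳ
      ; identityˡ = identityˡ
      ; identityʳ = identityʳ
      }

  module _ (em : ExcludedMiddle) where

    ∈-∨-∁ : ∀ A → x ∈ (A ∨ ∁ A)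
    ∈-∨-∁ {x} A with em (x ∈ A)
    ... | yes x∈A = lift true  , x∈A
    ... | no  x∉A = lift false , x∉A

    ⊆｛｝ : ∀ B → B ⊆ ｛ x ｝ → B ⊆ ⊥Q ⊎ ｛ x ｝ ⊆ B
    ⊆｛｝ {x} B B⊆x with em (x ∈ B)
    ... | yes x∈B = inj₂ (λ { refl → x∈B })
    ... | no  x∉B = inj₁ (λ y∈B → ⊥-elim (x∉B (subst B (B⊆x y∈B) y∈B)))

    isAtomicBoolean : IsAtomicBoolean (Pred X 0ℓ) _⊆_ ⋁
    isAtomicBoolean = record
      { ⊤Q       = U
      ; ⊤-max    = λ A _ → tt
      ; _⊓_      = _∩_
      ; ⊓-lowerˡ = λ A B → proj₁
      ; ⊓-lowerʳ = λ A B → proj₂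
      ; ⊓-glb    = λ A B C C⊆A C⊆B x∈C → C⊆A x∈C , C⊆B x∈C
      ; distrib  = λ { A B C (x∈A , (lift true  , x∈B)) → lift true  , x∈A , x∈B
                     ; A B C (x∈A , (lift false , x∈C)) → lift false , x∈A , x∈C }
      ; compl    = ∁
      ; compl-⊓  = λ A (x∈A , x∉A) → ⊥-elim (x∉A x∈A)
      ; compl-∨  = λ A _ → ∈-∨-∁ A
      ; atomic   = atomic
      }
      where
      atomic : ∀ A → ¬ (A ⊆ ⊥Q) → ∃[ t ] (((¬ (t ⊆ ⊥Q)) × (∀ B → B ⊆ t → B ⊆ ⊥Q ⊎ t ⊆ B)) × t ⊆ A)
      atomic A A⊈⊥ with em (∃[ x ] (x ∈ A))
      ... | yes (x , x∈A) = ｛ x ｝ , ((λ x⊆⊥ → ∉⊥Q {x} (x⊆⊥ refl)) , ⊆｛｝) , λ { refl → x∈A }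
      ... | no  A≡∅        = ⊥-elim (A⊈⊥ (λ {x} x∈A → ⊥-elim (A≡∅ (x , x∈A))))

module LRMultimagmaProperties (M : LRMultimagma) where

  open LRMultimagma M hiding (IsMultisemigroup; IsLocal; _⊙ₚ_)
  open ≡-Reasoning

  private variable
    a b e x z : Carrier

  ℓ-absorbs : x ∈ (ℓ x ⊙ x)
  ℓ-absorbs {x} = proj₂ (ℓ-unit x) refl

  r-absorbs : x ∈ (x ⊙ r x)
  r-absorbs {x} = proj₂ (r-unit x) refl

  r∘ℓ : ∀ x → r (ℓ x) ≡ ℓ x
  r∘ℓ x = D⇒r≡ℓ (ℓ x) x (x , ℓ-absorbs)

  ℓ∘r : ∀ x → ℓ (r x) ≡ r x
  ℓ∘r x = sym (D⇒r≡ℓ x (r x) (x , r-absorbs))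

  ℓ∘ℓ : ∀ x → ℓ (ℓ x) ≡ ℓ x
  ℓ∘ℓ x = begin
    ℓ (ℓ x)     ≡⟨ cong ℓ (sym (r∘ℓ x)) ⟩
    ℓ (r (ℓ x)) ≡⟨ ℓ∘r (ℓ x) ⟩
    r (ℓ x)     ≡⟨ r∘ℓ x ⟩
    ℓ x         ∎

  ℓ-fixed⇒r-fixed : ℓ e ≡ e → r e ≡ e
  ℓ-fixed⇒r-fixed {e} ℓe≡e = begin
    r e     ≡⟨ cong r (sym ℓe≡e) ⟩
    r (ℓ e) ≡⟨ r∘ℓ e ⟩
    ℓ e     ≡⟨ ℓe≡e ⟩
    e       ∎

  ⊙-unitˡ⁻¹ : ℓ e ≡ e → z ∈ (e ⊙ b) → z ≡ b × e ≡ ℓ b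
  ⊙-unitˡ⁻¹ {e} {z} {b} ℓe≡e z∈eb = proj₁ (ℓ-unit b) (subst (λ u → z ∈ (u ⊙ b)) e≡ℓb z∈eb) , e≡ℓb
    where e≡ℓb = trans (sym (ℓ-fixed⇒r-fixed ℓe≡e)) (D⇒r≡ℓ e b (z , z∈eb))

  ⊙-unitʳ⁻¹ : ℓ e ≡ e → z ∈ (a ⊙ e) → z ≡ a × r a ≡ e
  ⊙-unitʳ⁻¹ {e} {z} {a} ℓe≡e z∈ae = proj₁ (r-unit a) (subst (λ u → z ∈ (a ⊙ u)) (sym ra≡e) z∈ae) , ra≡e
    where ra≡e = trans (D⇒r≡ℓ a e (z , z∈ae)) ℓe≡e

  module _ (assoc : IsMultisemigroup M) where

    -- z ∈ (ℓ a ⊙ a) ⊙ b = ℓ a ⊙ (a ⊙ b), and ℓ a can only act on elements with left unit ℓ a.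
    ℓ-⊙ : z ∈ (a ⊙ b) → ℓ z ≡ ℓ a
    ℓ-⊙ {z} {a} {b} z∈ab with proj₂ (assoc (ℓ a) a b) (a , b , ℓ-absorbs , refl , z∈ab)
    ... | _ , _ , refl , _ , z∈ℓa⊙u with ⊙-unitˡ⁻¹ (ℓ∘ℓ a) z∈ℓa⊙u
    ... | refl , ℓa≡ℓz = sym ℓa≡ℓz

    r-⊙ : z ∈ (a ⊙ b) → r z ≡ r b
    r-⊙ {z} {a} {b} z∈ab with proj₁ (assoc a b (r b)) (a , b , refl , r-absorbs , z∈ab)
    ... | _ , _ , _ , refl , z∈u⊙rb with ⊙-unitʳ⁻¹ (ℓ∘r b) z∈u⊙rb
    ... | refl , rz≡rb = rz≡rb

module PowersetModal (M : LRMultimagma) where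

  open LRMultimagma M hiding (IsMultisemigroup; IsLocal; _⊙ₚ_)
  open LRMultimagmaProperties M
  open PowersetOf Carrier
  open Lifted _⊙_
  open import Relation.Binary.Reasoning.Setoid ≐-setoid

  private variable
    A B P Q : Pred Carrier 0ℓ

  image-ℓ⊆E : image ℓ A ⊆ E M
  image-ℓ⊆E (a , _ , refl) = ℓ∘ℓ a

  image-r⊆E : image r A ⊆ E M
  image-r⊆E (a , _ , refl) = ℓ∘r a

  E-actionˡ : P ⊆ E M → P · B ≐ (B ∩ (ℓ ⊢ P))
  E-actionˡ {P} {B} P⊆E = act , λ (b∈B , ℓb∈P) → ℓ _ , _ , ℓb∈P , b∈B , ℓ-absorbs
    where
    act : P · B ⊆ B ∩ (ℓ ⊢ P)
    act (e , b , e∈P , b∈B , z∈eb) with ⊙-unitˡ⁻¹ (P⊆E e∈P) z∈eb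
    ... | refl , refl = b∈B , e∈P

  E-actionʳ : P ⊆ E M → B · P ≐ (B ∩ (r ⊢ P))
  E-actionʳ {P} {B} P⊆E = act , λ (b∈B , rb∈P) → _ , r _ , b∈B , rb∈P , r-absorbs
    where
    act : B · P ⊆ B ∩ (r ⊢ P)
    act (b , e , b∈B , e∈P , z∈be) with ⊙-unitʳ⁻¹ (P⊆E e∈P) z∈be
    ... | refl , refl = b∈B , e∈P

  ·-subidentity : P ⊆ E M → Q ⊆ E M → P · Q ≐ (P ∩ Q)
  ·-subidentity {P} {Q} P⊆E Q⊆E =
      (λ z∈PQ → let (z∈Q , ℓz∈P) = proj₁ (E-actionˡ P⊆E) z∈PQ
                in subst P (Q⊆E z∈Q) ℓz∈P , z∈Q)
    , (λ (z∈P , z∈Q) → proj₂ (E-actionˡ P⊆E) (z∈Q , subst P (sym (Q⊆E z∈Q)) z∈P))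

  identityˡ : ∀ A → E M · A ≐ A
  identityˡ A = (λ a∈EA → proj₁ (proj₁ E·A a∈EA)) , (λ a∈A → proj₂ E·A (a∈A , ℓ∘ℓ _))
    where E·A = E-actionˡ (λ e∈E → e∈E)

  identityʳ : ∀ A → A · E M ≐ A
  identityʳ A = (λ a∈AE → proj₁ (proj₁ A·E a∈AE)) , (λ a∈A → proj₂ A·E (a∈A , ℓ∘r _))
    where A·E = E-actionʳ (λ e∈E → e∈E)

  isModalBase : IsModalBase (PX M) (_⊆′_ M) (⋃ M) _·_ (E M) (dom M) (cod M)
  isModalBase = record
    { isPrequantale = isPrequantale (E M) identityˡ identityʳ
    ; dom-cong      = image-cong ℓ
    ; cod-cong      = image-cong r
    ; dom-absorb    = λ A a∈A → proj₂ (E-actionˡ image-ℓ⊆E) (a∈A , (_ , a∈A , refl))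
    ; dom-subid     = λ A → image-ℓ⊆E
    ; dom-strict    = image-⊥ ℓ
    ; dom-join      = λ A B → image-∨ ℓ
    ; cod-absorb    = λ A a∈A → proj₂ (E-actionʳ image-r⊆E) (a∈A , (_ , a∈A , refl))
    ; cod-subid     = λ A → image-r⊆E
    ; cod-strict    = image-⊥ r
    ; cod-join      = λ A B → image-∨ r
    ; dom∘cod       = λ A → image-absorb ℓ r ℓ∘r
    ; cod∘dom       = λ A → image-absorb r ℓ r∘ℓ
    }

  dom-export : ∀ A B → image ℓ (image ℓ A · B) ≐ image ℓ A · image ℓ B
  dom-export A B = begin
    image ℓ (image ℓ A · B)          ≈⟨ image-cong ℓ (E-actionˡ image-ℓ⊆E) ⟩
    image ℓ (B ∩ (ℓ ⊢ image ℓ A))    ≈⟨ image-∩-⊢ ℓ ⟩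
    image ℓ B ∩ image ℓ A            ≈⟨ ∩-comm ⟩
    image ℓ A ∩ image ℓ B            ≈⟨ ·-subidentity image-ℓ⊆E image-ℓ⊆E ⟨
    image ℓ A · image ℓ B            ∎

  cod-export : ∀ A B → image r (B · image r A) ≐ image r B · image r A
  cod-export A B = begin
    image r (B · image r A)          ≈⟨ image-cong r (E-actionʳ image-r⊆E) ⟩
    image r (B ∩ (r ⊢ image r A))    ≈⟨ image-∩-⊢ r ⟩
    image r B ∩ image r A            ≈⟨ ·-subidentity image-r⊆E image-r⊆E ⟨
    image r B · image r A            ∎

  isModalPrequantale : IsModalPrequantale (PX M) (_⊆′_ M) (⋃ M) _·_ (E M) (dom M) (cod M)
  isModalPrequantale = record
    { isModalBase = isModalBase
    ; dom-export  = dom-export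
    ; cod-export  = cod-export
    }

  module _ (assoc : IsMultisemigroup M) where

    isWeaklyLocalModalQuantale :
      IsWeaklyLocalModalQuantale (PX M) (_⊆′_ M) (⋃ M) _·_ (E M) (dom M) (cod M)
    isWeaklyLocalModalQuantale = record
      { isModalPrequantale = isModalPrequantale
      ; ·-assoc            = ·-assoc assoc
      }

    module _ (local : IsLocal M) where

      image-ℓ-· : image ℓ (A · B) ≐ image ℓ (A ∩ (r ⊢ image ℓ B))
      image-ℓ-· =
          (λ { (z , (a , b , a∈A , b∈B , z∈ab) , refl) →
                 a , (a∈A , (b , b∈B , sym (D⇒r≡ℓ a b (z , z∈ab)))) , sym (ℓ-⊙ assoc z∈ab) })
        , (λ { (a , (a∈A , (b , b∈B , ℓb≡ra)) , refl) →
                 let (w , w∈ab) = local a b (sym ℓb≡ra)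
                 in w , (a , b , a∈A , b∈B , w∈ab) , ℓ-⊙ assoc w∈ab })

      image-r-· : image r (A · B) ≐ image r (B ∩ (ℓ ⊢ image r A))
      image-r-· =
          (λ { (z , (a , b , a∈A , b∈B , z∈ab) , refl) →
                 b , (b∈B , (a , a∈A , D⇒r≡ℓ a b (z , z∈ab))) , sym (r-⊙ assoc z∈ab) })
        , (λ { (b , (b∈B , (a , a∈A , ra≡ℓb)) , refl) →
                 let (w , w∈ab) = local a b ra≡ℓb
                 in w , (a , b , a∈A , b∈B , w∈ab) , r-⊙ assoc w∈ab })

      dom-local : ∀ A B → image ℓ (A · image ℓ B) ≐ image ℓ (A · B)
      dom-local A B = begin
        image ℓ (A · image ℓ B)          ≈⟨ image-cong ℓ (E-actionʳ image-ℓ⊆E) ⟩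
        image ℓ (A ∩ (r ⊢ image ℓ B))    ≈⟨ image-ℓ-· ⟨
        image ℓ (A · B)                  ∎

      cod-local : ∀ A B → image r (image r A · B) ≐ image r (A · B)
      cod-local A B = begin
        image r (image r A · B)          ≈⟨ image-cong r (E-actionˡ image-r⊆E) ⟩
        image r (B ∩ (ℓ ⊢ image r A))    ≈⟨ image-r-· ⟨
        image r (A · B)                  ∎

      isModalQuantale : IsModalQuantale (PX M) (_⊆′_ M) (⋃ M) _·_ (E M) (dom M) (cod M)
      isModalQuantale = record
        { isModalBase = isModalBase
        ; ·-assoc     = ·-assoc assoc
        ; dom-local   = dom-local
        ; cod-local   = cod-local
        }

theorem6p4 : (M : LRMultimagma) →
    IsModalPrequantale (PX M) (_⊆′_ M) (⋃ M) (_⊙ₚ_ M) (E M) (dom M) (cod M)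
    × (ExcludedMiddle → IsAtomicBoolean (PX M) (_⊆′_ M) (⋃ M))
    × (IsMultisemigroup M → IsWeaklyLocalModalQuantale (PX M) (_⊆′_ M) (⋃ M) (_⊙ₚ_ M) (E M) (dom M) (cod M))
    × (IsMultisemigroup M → IsLocal M → IsModalQuantale (PX M) (_⊆′_ M) (⋃ M) (_⊙ₚ_ M) (E M) (dom M) (cod M))
theorem6p4 M =
    isModalPrequantale
  , isAtomicBoolean
  , isWeaklyLocalModalQuantale
  , isModalQuantale
  where
  open PowersetModal M
  open PowersetOf (LRMultimagma.Carrier M) using (isAtomicBoolean)
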